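{- For every integer $k\ge 3$ there exist a graph $G^{(k)}$ and a set $A_k\subseteq V(G^{(k)})$ such that $A_k$ is a $(k-1)$-Steiner general position set of $G^{(k)}$ but $A_k$ is not a $k$-Steiner general position set of $G^{(k)}$.
   Context: All graphs are finite and simple. For a nonempty $W\subseteq V(G)$, the Steiner distance $d_G(W)$ is the minimum number of edges of a connected subgraph of $G$ containing $W$ ($\infty$ if none exists); such a minimum subgraph is a tree, called a Steiner $W$-tree. For a positive integer $k$, a set $A\subseteq V(G)$ is a $k$-Steiner general position set if for every $B\subseteq A$ with $|B|=k$ and every Steiner $B$-tree $T_B$ we have $V(T_B)\cap A=B$. -}

module Defs where

open import Data.Nat using (ℕ)
open import Data.Fin using (Fin; _<_)
open import Data.Fin.Subset using (Subset; _∈_; _⊆_; ∣_∣; _∩_)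
open import Data.Product using (_×_; _,_)
open import Data.Sum using (_⊎_)
open import Data.List using (List; length)
open import Data.List.Relation.Unary.All using (All)
open import Data.List.Relation.Unary.Unique.Propositional using (Unique)
import Data.List.Membership.Propositional as LM
open import Relation.Binary.PropositionalEquality using (_≡_)
open import Relation.Nullary using (¬_)

record Graph (n : ℕ) : Set₁ where
  field
    Adj   : Fin n → Fin n → Set
    sym   : ∀ {u v} → Adj u v → Adj v u
    irrefl : ∀ {u} → ¬ Adj u u

-- An edge {u,v} is stored as the ordered pair (u , v) with u < v.
Edge : ℕ → Set
Edge n = Fin n × Fin n

EdgeIn : ∀ {n} → List (Edge n) → Fin n → Fin n → Set
EdgeIn E u w = LM._∈_ (u , w) E ⊎ LM._∈_ (w , u) E

data Reach {n : ℕ} (E : List (Edge n)) : Fin n → Fin n → Set where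
  here : ∀ {u} → Reach E u u
  step : ∀ {u w v} → EdgeIn E u w → Reach E w v → Reach E u v

record Subgraph {n : ℕ} (G : Graph n) : Set where
  field
    verts        : Subset n
    edges        : List (Edge n)
    edges-unique : Unique edges
    edges-ord    : All (λ e → Data.Product.proj₁ e < Data.Product.proj₂ e) edges
    edges-inG    : All (λ e → Graph.Adj G (Data.Product.proj₁ e) (Data.Product.proj₂ e)) edges
    edges-verts  : All (λ e → (Data.Product.proj₁ e ∈ verts) × (Data.Product.proj₂ e ∈ verts)) edges

size : ∀ {n} {G : Graph n} → Subgraph G → ℕ
size H = length (Subgraph.edges H)

Connected : ∀ {n} {G : Graph n} → Subgraph G → Set
Connected H = ∀ {u v} → u ∈ Subgraph.verts H → v ∈ Subgraph.verts H →
              Reach (Subgraph.edges H) u v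

ConnContaining : ∀ {n} {G : Graph n} → Subset n → Subgraph G → Set
ConnContaining W H = Connected H × (W ⊆ Subgraph.verts H)

SteinerTree : ∀ {n} (G : Graph n) → Subset n → Subgraph G → Set
SteinerTree G W T = ConnContaining W T ×
  (∀ (H : Subgraph G) → ConnContaining W H → size T Data.Nat.≤ size H)

SteinerGP : ∀ {n} (G : Graph n) → ℕ → Subset n → Set
SteinerGP {n} G k A = ∀ (B : Subset n) → B ⊆ A → ∣ B ∣ ≡ k →
  ∀ (T : Subgraph G) → SteinerTree G B T → (Subgraph.verts T ∩ A) ≡ B

-- The graph has vertices b₀, …, b_{k-1}, a, h₀, …, h_{k-1}; the hub h_j is adjacent to a and to
-- every b_i with i ≠ j, and b₀ is also adjacent to a.  Let A = {b₀, …, b_{k-1}, a}.  All counting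
-- rests on |V(H)| ≤ |E(H)| + 1 for connected H.
-- A (k-1)-subset B of A misses some b_x, so the star at h_x connects B with k - 1 edges.  A connected
-- subgraph containing B and one more vertex of A contains some b_y with y > 0, whose neighbours
-- are all hubs, hence it has at least k edges; so Steiner B-trees meet A only in B.
-- For B₀ = {b₀, …, b_{k-1}} every connecting subgraph needs k + 1 edges (a neighbour p of b₀ is
-- not adjacent to some b_j, which then needs a further neighbour), and the tree b₀ a h₀ b_i
-- (0 < i < k) attains this while passing through a.
module Submission where

open import Defs
open import Data.Nat using (ℕ; zero; suc; _+_; _∸_; _≤_; _<_; z≤n; s≤s; s≤s⁻¹)
open import Data.Nat.Properties hiding (_≟_)
open import Data.Fin using (Fin; toℕ; fromℕ<; _≟_) renaming (zero to fzero; suc to fsuc)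
open import Data.Fin.Properties using (any?; toℕ-fromℕ<; toℕ-injective; toℕ<n)
import Data.Fin.Properties as Fin
open import Data.Fin.Subset
open import Data.Fin.Subset.Properties
open import Data.Bool using (true; false)
open import Data.Vec using (_∷_; []; here; there)
open import Data.List using (List; []; _∷_; length; map)
open import Data.List.Properties using (length-map)
open import Data.List.Relation.Unary.All as All using (All)
import Data.List.Relation.Unary.Any as Any
import Data.List.Relation.Unary.AllPairs as AllPairs
open import Data.List.Relation.Unary.Unique.Propositional using (Unique)
import Data.List.Relation.Unary.Unique.Propositional.Properties as Unique
import Data.List.Membership.Propositional as List
open import Data.List.Membership.Propositional.Properties using (∈-map⁺; ∈-map⁻)
open import Data.Product using (Σ; ∃; _×_; _,_; proj₁; proj₂)
open import Data.Sum using (_⊎_; inj₁; inj₂; swap)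
open import Function using (_∘_)
open import Relation.Nullary using (¬_; yes; no; contradiction)
open import Relation.Nullary.Decidable using (_×-dec_; ¬?; decidable-stable)
open import Relation.Binary.PropositionalEquality

∣p∪q∣≤∣p∣+∣q∣ : ∀ {n} (p q : Subset n) → ∣ p ∪ q ∣ ≤ ∣ p ∣ + ∣ q ∣
∣p∪q∣≤∣p∣+∣q∣ [] [] = z≤n
∣p∪q∣≤∣p∣+∣q∣ (true  ∷ p) (true  ∷ q) =
  s≤s (≤-trans (∣p∪q∣≤∣p∣+∣q∣ p q) (+-monoʳ-≤ ∣ p ∣ (n≤1+n ∣ q ∣)))
∣p∪q∣≤∣p∣+∣q∣ (true  ∷ p) (false ∷ q) = s≤s (∣p∪q∣≤∣p∣+∣q∣ p q)
∣p∪q∣≤∣p∣+∣q∣ (false ∷ p) (true  ∷ q) =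
  ≤-trans (s≤s (∣p∪q∣≤∣p∣+∣q∣ p q)) (≤-reflexive (sym (+-suc ∣ p ∣ ∣ q ∣)))
∣p∪q∣≤∣p∣+∣q∣ (false ∷ p) (false ∷ q) = ∣p∪q∣≤∣p∣+∣q∣ p q

x∈p─q⇒x∉q : ∀ {n} {x : Fin n} (p q : Subset n) → x ∈ p ─ q → x ∉ q
x∈p─q⇒x∉q (true ∷ p) (false ∷ q) here ()
x∈p─q⇒x∉q (_ ∷ p) (_ ∷ q) (there x∈p─q) (there x∈q) = x∈p─q⇒x∉q p q x∈p─q x∈q

module _ {n : ℕ} where

  ∣p∣≤1+∣p-x∣ : ∀ (p : Subset n) x → ∣ p ∣ ≤ suc ∣ p - x ∣
  ∣p∣≤1+∣p-x∣ p x = begin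
    ∣ p ∣                 ≤⟨ p⊆q⇒∣p∣≤∣q∣ p⊆[p-x]∪⁅x⁆ ⟩
    ∣ (p - x) ∪ ⁅ x ⁆ ∣   ≤⟨ ∣p∪q∣≤∣p∣+∣q∣ (p - x) ⁅ x ⁆ ⟩
    ∣ p - x ∣ + ∣ ⁅ x ⁆ ∣ ≡⟨ cong (∣ p - x ∣ +_) (∣⁅x⁆∣≡1 x) ⟩
    ∣ p - x ∣ + 1         ≡⟨ +-comm ∣ p - x ∣ 1 ⟩
    suc ∣ p - x ∣         ∎
    where
    open ≤-Reasoning
    p⊆[p-x]∪⁅x⁆ : p ⊆ (p - x) ∪ ⁅ x ⁆
    p⊆[p-x]∪⁅x⁆ {y} y∈p with y ≟ x
    ... | yes refl = q⊆p∪q (p - x) ⁅ x ⁆ (x∈⁅x⁆ x)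
    ... | no  y≢x  = p⊆p∪q ⁅ x ⁆ (x∈p∧x≢y⇒x∈p-y y∈p y≢x)

  x∉p⇒∣p∣<∣p∪⁅x⁆∣ : ∀ {p : Subset n} {x} → x ∉ p → ∣ p ∣ < ∣ p ∪ ⁅ x ⁆ ∣
  x∉p⇒∣p∣<∣p∪⁅x⁆∣ {p} {x} x∉p =
    p⊂q⇒∣p∣<∣q∣ (p⊆p∪q ⁅ x ⁆ , x , q⊆p∪q p ⁅ x ⁆ (x∈⁅x⁆ x) , x∉p)

  ∣p∣<∣q∣⇒∃∈q∉p : ∀ {p q : Subset n} → ∣ p ∣ < ∣ q ∣ → ∃ λ x → x ∈ q × x ∉ p
  ∣p∣<∣q∣⇒∃∈q∉p {p} {q} ∣p∣<∣q∣ with any? (λ x → x ∈? q ×-dec ¬? (x ∈? p))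
  ... | yes found = found
  ... | no  none  = contradiction (p⊆q⇒∣p∣≤∣q∣ q⊆p) (<⇒≱ ∣p∣<∣q∣)
    where
    q⊆p : q ⊆ p
    q⊆p {x} x∈q = decidable-stable (x ∈? p) (λ x∉p → none (x , x∈q , x∉p))

  p⊆q∧x∈q⇒p∪⁅x⁆⊆q : ∀ {p q : Subset n} {x} → p ⊆ q → x ∈ q → p ∪ ⁅ x ⁆ ⊆ q
  p⊆q∧x∈q⇒p∪⁅x⁆⊆q {p} {q} {x} p⊆q x∈q y∈ with x∈p∪q⁻ p ⁅ x ⁆ y∈
  ... | inj₁ y∈p = p⊆q y∈p
  ... | inj₂ y∈x = subst (_∈ q) (sym (x∈⁅y⁆⇒x≡y x y∈x)) x∈q

  subsingleton⇒∣p∣≤1 : ∀ {p : Subset n} → (∀ {x y} → x ∈ p → y ∈ p → x ≡ y) → ∣ p ∣ ≤ 1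
  subsingleton⇒∣p∣≤1 {p} unique with nonempty? p
  ... | yes (x , x∈p) = ≤-trans (p⊆q⇒∣p∣≤∣q∣ p⊆⁅x⁆) (≤-reflexive (∣⁅x⁆∣≡1 x))
    where
    p⊆⁅x⁆ : p ⊆ ⁅ x ⁆
    p⊆⁅x⁆ y∈p = subst (_∈ ⁅ x ⁆) (unique x∈p y∈p) (x∈⁅x⁆ x)
  ... | no  empty = ≤-trans (≤-reflexive (trans (cong ∣_∣ (Empty-unique empty)) (∣⊥∣≡0 n))) z≤n

module _ {n : ℕ} {E : List (Edge n)} where

  EdgeIn-sym : ∀ {u w} → EdgeIn E u w → EdgeIn E w u
  EdgeIn-sym (inj₁ uw∈E) = inj₂ uw∈E
  EdgeIn-sym (inj₂ wu∈E) = inj₁ wu∈E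

  Reach-trans : ∀ {u v w} → Reach E u v → Reach E v w → Reach E u w
  Reach-trans here          r′ = r′
  Reach-trans (step uw∈E r) r′ = step uw∈E (Reach-trans r r′)

  Reach-sym : ∀ {u v} → Reach E u v → Reach E v u
  Reach-sym here          = here
  Reach-sym (step uw∈E r) = Reach-trans (Reach-sym r) (step (EdgeIn-sym uw∈E) here)

  Reach-∷ : ∀ {e u v} → Reach E u v → Reach (e ∷ E) u v
  Reach-∷ here                 = here
  Reach-∷ (step (inj₁ uw∈E) r) = step (inj₁ (Any.there uw∈E)) (Reach-∷ r)
  Reach-∷ (step (inj₂ wu∈E) r) = step (inj₂ (Any.there wu∈E)) (Reach-∷ r)

module _ {n : ℕ} where

  redirect : Fin n → Fin n → Fin n → Fin n
  redirect c d t with t ≟ c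
  ... | yes _ = d
  ... | no  _ = t

  redirect-source : ∀ c d → redirect c d c ≡ d
  redirect-source c d with c ≟ c
  ... | yes _   = refl
  ... | no  c≢c = contradiction refl c≢c

  redirect-target : ∀ c d → redirect c d d ≡ d
  redirect-target c d with d ≟ c
  ... | yes _ = refl
  ... | no  _ = refl

  redirect-other : ∀ c d {t} → t ≢ c → redirect c d t ≡ t
  redirect-other c d {t} t≢c with t ≟ c
  ... | yes t≡c = contradiction t≡c t≢c
  ... | no  _   = refl

  -- root E u is a canonical vertex of the component of u in the graph with edge list E:
  -- adding the edge (x , y) merges the component of y into that of x.
  root : List (Edge n) → Fin n → Fin n
  root []            u = u
  root ((x , y) ∷ E) u = redirect (root E y) (root E x) (root E u)

  root-edge : ∀ E {u w} → (u , w) List.∈ E → root E u ≡ root E w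
  root-edge ((x , y) ∷ E) (Any.here refl) =
    trans (redirect-target (root E y) (root E x)) (sym (redirect-source (root E y) (root E x)))
  root-edge ((x , y) ∷ E) (Any.there uw∈E) =
    cong (redirect (root E y) (root E x)) (root-edge E uw∈E)

  root-Reach : ∀ {E u v} → Reach E u v → root E u ≡ root E v
  root-Reach         here                 = refl
  root-Reach {E = E} (step (inj₁ uw∈E) r) = trans (root-edge E uw∈E) (root-Reach r)
  root-Reach {E = E} (step (inj₂ wu∈E) r) = trans (sym (root-edge E wu∈E)) (root-Reach r)

  DistinctRoots : List (Edge n) → Subset n → Set
  DistinctRoots E R = ∀ {r s} → r ∈ R → s ∈ R → root E r ≡ root E s → r ≡ s

  DistinctRoots-∷ : ∀ E {R} x y → DistinctRoots E R →
                    (∀ {r} → r ∈ R → root E r ≢ root E y) → DistinctRoots ((x , y) ∷ E) R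
  DistinctRoots-∷ E x y distinct avoids-y r∈R s∈R roots≡ = distinct r∈R s∈R (begin
    root E _                                   ≡⟨ sym (redirect-other _ _ (avoids-y r∈R)) ⟩
    redirect (root E y) (root E x) (root E _)  ≡⟨ roots≡ ⟩
    redirect (root E y) (root E x) (root E _)  ≡⟨ redirect-other _ _ (avoids-y s∈R) ⟩
    root E _                                   ∎)
    where open ≡-Reasoning

  -- Each edge merges at most two components, so it costs at most one representative.
  representatives : ∀ E (V : Subset n) →
    ∃ λ R → R ⊆ V × ∣ V ∣ ≤ ∣ R ∣ + length E × DistinctRoots E R
  representatives [] V = V , (λ r∈V → r∈V) , ≤-reflexive (sym (+-identityʳ ∣ V ∣)) , λ _ _ eq → eq
  representatives ((x , y) ∷ E) V with representatives E V
  ... | R , R⊆V , ∣V∣≤ , distinct with any? (λ r → r ∈? R ×-dec root E r ≟ root E y)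
  ... | yes (r₀ , r₀∈R , r₀~y) =
    R - r₀ , R⊆V ∘ p─q⊆p R ⁅ r₀ ⁆ , bound ,
    DistinctRoots-∷ E x y (λ r∈ s∈ → distinct (p─q⊆p R ⁅ r₀ ⁆ r∈) (p─q⊆p R ⁅ r₀ ⁆ s∈)) avoids-y
    where
    bound : ∣ V ∣ ≤ ∣ R - r₀ ∣ + suc (length E)
    bound = ≤-trans ∣V∣≤ (≤-trans (+-monoˡ-≤ (length E) (∣p∣≤1+∣p-x∣ R r₀))
                                  (≤-reflexive (sym (+-suc ∣ R - r₀ ∣ (length E)))))
    avoids-y : ∀ {r} → r ∈ R - r₀ → root E r ≢ root E y
    avoids-y r∈ r~y = x∈p─q⇒x∉q R ⁅ r₀ ⁆ r∈
      (subst (_∈ ⁅ r₀ ⁆) (sym (distinct (p─q⊆p R ⁅ r₀ ⁆ r∈) r₀∈R (trans r~y (sym r₀~y)))) (x∈⁅x⁆ r₀))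
  ... | no none =
    R , R⊆V , ≤-trans ∣V∣≤ (+-monoʳ-≤ ∣ R ∣ (n≤1+n (length E))) ,
    DistinctRoots-∷ E x y distinct (λ r∈R r~y → none (_ , r∈R , r~y))

IsolatedIn : ∀ {n} → Graph n → Fin n → Subset n → Set
IsolatedIn G y S = ∀ {v} → Graph.Adj G y v → v ∉ S

module _ {n : ℕ} {G : Graph n} (H : Subgraph G) (connected : Connected H) where
  open Subgraph H

  ∣verts∣≤1+size : ∣ verts ∣ ≤ suc (size H)
  ∣verts∣≤1+size with representatives edges verts
  ... | R , R⊆V , ∣V∣≤ , distinct = ≤-trans ∣V∣≤ (+-monoˡ-≤ (size H) ∣R∣≤1)
    where
    ∣R∣≤1 : ∣ R ∣ ≤ 1
    ∣R∣≤1 = subsingleton⇒∣p∣≤1 λ r∈R s∈R →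
      distinct r∈R s∈R (root-Reach (connected (R⊆V r∈R) (R⊆V s∈R)))

  ∃-neighbour : ∀ {u w} → u ∈ verts → w ∈ verts → u ≢ w →
                ∃ λ p → Graph.Adj G u p × p ∈ verts
  ∃-neighbour u∈H w∈H u≢w with connected u∈H w∈H
  ... | here = contradiction refl u≢w
  ... | step (inj₁ up∈E) _ = _ , All.lookup edges-inG up∈E , proj₂ (All.lookup edges-verts up∈E)
  ... | step (inj₂ pu∈E) _ =
    _ , Graph.sym G (All.lookup edges-inG pu∈E) , proj₁ (All.lookup edges-verts pu∈E)

  -- A walk in H from y to another vertex of S leaves S at its first step.
  isolated⇒∣S∣≤size : ∀ {S y} → S ⊆ verts → y ∈ S → 2 ≤ ∣ S ∣ → IsolatedIn G y S → ∣ S ∣ ≤ size H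
  isolated⇒∣S∣≤size {S} {y} S⊆H y∈S 2≤∣S∣ isolated
    with ∣p∣<∣q∣⇒∃∈q∉p {p = ⁅ y ⁆} (subst (_< ∣ S ∣) (sym (∣⁅x⁆∣≡1 y)) 2≤∣S∣)
  ... | z , z∈S , z∉⁅y⁆ with ∃-neighbour (S⊆H y∈S) (S⊆H z∈S) (z∉⁅y⁆ ∘ λ y≡z → subst (_∈ ⁅ y ⁆) y≡z (x∈⁅x⁆ y))
  ... | p , y~p , p∈H = s≤s⁻¹ (≤-trans (p⊂q⇒∣p∣<∣q∣ (S⊆H , p , p∈H , isolated y~p)) ∣verts∣≤1+size)

elements : ∀ {n} → Subset n → List (Fin n)
elements []          = []
elements (true  ∷ p) = fzero ∷ map fsuc (elements p)
elements (false ∷ p) = map fsuc (elements p)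

length-elements : ∀ {n} (p : Subset n) → length (elements p) ≡ ∣ p ∣
length-elements []          = refl
length-elements (true  ∷ p) = cong suc (trans (length-map fsuc (elements p)) (length-elements p))
length-elements (false ∷ p) = trans (length-map fsuc (elements p)) (length-elements p)

∈-elements⁺ : ∀ {n} {x : Fin n} (p : Subset n) → x ∈ p → x List.∈ elements p
∈-elements⁺ (true  ∷ p) here         = Any.here refl
∈-elements⁺ (true  ∷ p) (there x∈p)  = Any.there (∈-map⁺ fsuc (∈-elements⁺ p x∈p))
∈-elements⁺ (false ∷ p) (there x∈p)  = ∈-map⁺ fsuc (∈-elements⁺ p x∈p)

∈-elements⁻ : ∀ {n} {x : Fin n} (p : Subset n) → x List.∈ elements p → x ∈ p
∈-elements⁻ (true ∷ p) (Any.here refl) = here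
∈-elements⁻ (true ∷ p) (Any.there x∈) with ∈-map⁻ fsuc x∈
... | _ , y∈ , refl = there (∈-elements⁻ p y∈)
∈-elements⁻ (false ∷ p) x∈ with ∈-map⁻ fsuc x∈
... | _ , y∈ , refl = there (∈-elements⁻ p y∈)

elements-unique : ∀ {n} (p : Subset n) → Unique (elements p)
elements-unique []          = AllPairs.[]
elements-unique (true  ∷ p) =
  All.tabulate zero∉ AllPairs.∷ Unique.map⁺ Fin.suc-injective (elements-unique p)
  where
  zero∉ : ∀ {y} → y List.∈ map fsuc (elements p) → fzero ≢ y
  zero∉ y∈ with ∈-map⁻ fsuc y∈
  ... | _ , _ , refl = λ ()
elements-unique (false ∷ p) = Unique.map⁺ Fin.suc-injective (elements-unique p)

module Star {n : ℕ} (G : Graph n) (c : Fin n) (L : Subset n)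
            (below : ∀ {y} → y ∈ L → toℕ y < toℕ c) (adjacent : ∀ {y} → y ∈ L → Graph.Adj G y c) where

  spokes : List (Edge n)
  spokes = map (_, c) (elements L)

  All-spokes : ∀ {P : Edge n → Set} → (∀ {y} → y ∈ L → P (y , c)) → All P spokes
  All-spokes {P} P-spoke = All.tabulate P-member
    where
    P-member : ∀ {e} → e List.∈ spokes → P e
    P-member e∈ with ∈-map⁻ (_, c) e∈
    ... | _ , y∈ , refl = P-spoke (∈-elements⁻ L y∈)

  star : Subgraph G
  star = record
    { verts        = L ∪ ⁅ c ⁆
    ; edges        = spokes
    ; edges-unique = Unique.map⁺ (cong proj₁) (elements-unique L)
    ; edges-ord    = All-spokes below
    ; edges-inG    = All-spokes adjacent
    ; edges-verts  = All-spokes λ y∈L → p⊆p∪q ⁅ c ⁆ y∈L , q⊆p∪q L ⁅ c ⁆ (x∈⁅x⁆ c)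
    }

  size-star : size star ≡ ∣ L ∣
  size-star = trans (length-map (_, c) (elements L)) (length-elements L)

  L⊆star : L ⊆ Subgraph.verts star
  L⊆star = p⊆p∪q ⁅ c ⁆

  star-connected : Connected star
  star-connected u∈ v∈ = Reach-trans (to-centre u∈) (Reach-sym (to-centre v∈))
    where
    to-centre : ∀ {u} → u ∈ L ∪ ⁅ c ⁆ → Reach spokes u c
    to-centre u∈ with x∈p∪q⁻ L ⁅ c ⁆ u∈
    ... | inj₁ u∈L = step (inj₁ (∈-map⁺ (_, c) (∈-elements⁺ L u∈L))) here
    ... | inj₂ u∈c rewrite x∈⁅y⁆⇒x≡y _ u∈c = here

module AddLeaf {n : ℕ} {G : Graph n} (H : Subgraph G) (connected : Connected H) (u w : Fin n)
               (u∉H : u ∉ Subgraph.verts H) (w∈H : w ∈ Subgraph.verts H)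
               (u~w : Graph.Adj G u w) (u<w : toℕ u < toℕ w) where
  open Subgraph H

  grown : Subgraph G
  grown = record
    { verts        = verts ∪ ⁅ u ⁆
    ; edges        = (u , w) ∷ edges
    ; edges-unique = All.tabulate uw∉ AllPairs.∷ edges-unique
    ; edges-ord    = u<w All.∷ edges-ord
    ; edges-inG    = u~w All.∷ edges-inG
    ; edges-verts  = (q⊆p∪q verts ⁅ u ⁆ (x∈⁅x⁆ u) , old w∈H)
                     All.∷ All.map (λ (x∈H , y∈H) → old x∈H , old y∈H) edges-verts
    }
    where
    old : verts ⊆ verts ∪ ⁅ u ⁆
    old = p⊆p∪q ⁅ u ⁆
    uw∉ : ∀ {e} → e List.∈ edges → (u , w) ≢ e
    uw∉ e∈ refl = u∉H (proj₁ (All.lookup edges-verts e∈))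

  grown-connected : Connected grown
  grown-connected x∈ y∈ = Reach-trans (to-w x∈) (Reach-sym (to-w y∈))
    where
    to-w : ∀ {x} → x ∈ verts ∪ ⁅ u ⁆ → Reach ((u , w) ∷ edges) x w
    to-w x∈ with x∈p∪q⁻ verts ⁅ u ⁆ x∈
    ... | inj₁ x∈H = Reach-∷ (connected x∈H w∈H)
    ... | inj₂ x∈u rewrite x∈⁅y⁆⇒x≡y u x∈u = step (inj₁ (Any.here refl)) here

initial : ∀ {m} → ℕ → Subset m
initial {zero}  _       = []
initial {suc m} zero    = ⊥
initial {suc m} (suc l) = true ∷ initial l

∈-initial⁻ : ∀ {m} l {x : Fin m} → x ∈ initial l → toℕ x < l
∈-initial⁻ {suc m} zero    x∈⊥         = contradiction x∈⊥ ∉⊥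
∈-initial⁻ {suc m} (suc l) here        = s≤s z≤n
∈-initial⁻ {suc m} (suc l) (there x∈)  = s≤s (∈-initial⁻ l x∈)

∈-initial⁺ : ∀ {m} l {x : Fin m} → toℕ x < l → x ∈ initial l
∈-initial⁺ {suc m} (suc l) {fzero}  _       = here
∈-initial⁺ {suc m} (suc l) {fsuc x} (s≤s x<l) = there (∈-initial⁺ l x<l)

∣initial∣ : ∀ {m} l → l ≤ m → ∣ initial {m} l ∣ ≡ l
∣initial∣ {zero}  zero    _         = refl
∣initial∣ {suc m} zero    _         = ∣⊥∣≡0 (suc m)
∣initial∣ {suc m} (suc l) (s≤s l≤m) = cong suc (∣initial∣ l l≤m)

-- Vertex i < k is b_i, vertex k is a and vertex k + 1 + i is h_i (i < k); each edge is
-- recorded once as an Arc from its smaller end.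
module Construction (k : ℕ) (3≤k : 3 ≤ k) where

  n : ℕ
  n = suc (k + k)

  data Arc (u v : Fin n) : Set where
    b₀a : toℕ u ≡ 0 → toℕ v ≡ k → Arc u v
    bh  : toℕ u < k → k < toℕ v → toℕ v ≢ suc (k + toℕ u) → Arc u v
    ah  : toℕ u ≡ k → k < toℕ v → Arc u v

  Adj : Fin n → Fin n → Set
  Adj u v = Arc u v ⊎ Arc v u

  0<k : 0 < k
  0<k = ≤-trans (s≤s z≤n) 3≤k

  1<k : 1 < k
  1<k = ≤-trans (s≤s (s≤s z≤n)) 3≤k

  Arc⇒k≤target : ∀ {u v} → Arc u v → k ≤ toℕ v
  Arc⇒k≤target (b₀a _ v≡k) = ≤-reflexive (sym v≡k)
  Arc⇒k≤target (bh _ k<v _) = <⇒≤ k<v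
  Arc⇒k≤target (ah _ k<v)   = <⇒≤ k<v

  Arc⇒< : ∀ {u v} → Arc u v → toℕ u < toℕ v
  Arc⇒< (b₀a u≡0 v≡k)  = subst₂ _<_ (sym u≡0) (sym v≡k) 0<k
  Arc⇒< (bh u<k k<v _) = <-trans u<k k<v
  Arc⇒< (ah u≡k k<v)   = subst (_< _) (sym u≡k) k<v

  Adj-irrefl : ∀ {u} → ¬ Adj u u
  Adj-irrefl (inj₁ uu) = <-irrefl refl (Arc⇒< uu)
  Adj-irrefl (inj₂ uu) = <-irrefl refl (Arc⇒< uu)

  Adj-sym : ∀ {u v} → Adj u v → Adj v u
  Adj-sym = swap

  G : Graph n
  G = record { Adj = Adj ; sym = Adj-sym ; irrefl = Adj-irrefl }

  b-neighbour-cases : ∀ {u v} → Adj u v → toℕ u < k →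
                (toℕ u ≡ 0 × toℕ v ≡ k) ⊎ (k < toℕ v × toℕ v ≢ suc (k + toℕ u))
  b-neighbour-cases (inj₁ (b₀a u≡0 v≡k)) _   = inj₁ (u≡0 , v≡k)
  b-neighbour-cases (inj₁ (bh _ k<v v≢)) _   = inj₂ (k<v , v≢)
  b-neighbour-cases (inj₁ (ah u≡k _))    u<k = contradiction u≡k (<⇒≢ u<k)
  b-neighbour-cases (inj₂ vu)            u<k = contradiction (Arc⇒k≤target vu) (<⇒≱ u<k)

  b-neighbour-≥k : ∀ {u v} → Adj u v → toℕ u < k → k ≤ toℕ v
  b-neighbour-≥k u~v u<k with b-neighbour-cases u~v u<k
  ... | inj₁ (_ , v≡k) = ≤-reflexive (sym v≡k)
  ... | inj₂ (k<v , _) = <⇒≤ k<v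

  inner-b-neighbour>k : ∀ {u v} → Adj u v → 0 < toℕ u → toℕ u < k → k < toℕ v
  inner-b-neighbour>k u~v 0<u u<k with b-neighbour-cases u~v u<k
  ... | inj₁ (u≡0 , _) = contradiction u≡0 (>⇒≢ 0<u)
  ... | inj₂ (k<v , _) = k<v

  k<n : k < n
  k<n = s≤s (m≤m+n k k)

  b₀ b₁ a : Fin n
  b₀ = fromℕ< (s≤s z≤n)
  b₁ = fromℕ< (<-trans 1<k k<n)
  a  = fromℕ< k<n

  h<n : ∀ i → i < k → suc (k + i) < n
  h<n i i<k = s≤s (subst (_≤ k + k) (+-suc k i) (+-monoʳ-≤ k i<k))

  h : (i : ℕ) → i < k → Fin n
  h i i<k = fromℕ< (h<n i i<k)

  toℕ-b₁ : toℕ b₁ ≡ 1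
  toℕ-b₁ = toℕ-fromℕ< (<-trans 1<k k<n)

  toℕ-a : toℕ a ≡ k
  toℕ-a = toℕ-fromℕ< k<n

  b₁<k : toℕ b₁ < k
  b₁<k = subst (_< k) (sym toℕ-b₁) 1<k

  b₀≢b₁ : b₀ ≢ b₁
  b₀≢b₁ b₀≡b₁ = 0≢1+n (trans (cong toℕ b₀≡b₁) toℕ-b₁)

  toℕ-h : ∀ i (i<k : i < k) → toℕ (h i i<k) ≡ suc (k + i)
  toℕ-h i i<k = toℕ-fromℕ< (h<n i i<k)

  k<h : ∀ i (i<k : i < k) → k < toℕ (h i i<k)
  k<h i i<k = subst (k <_) (sym (toℕ-h i i<k)) (s≤s (m≤m+n k i))

  hub-index : ∀ p → k < toℕ p → ∃ λ i → i < k × toℕ p ≡ suc (k + i)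
  hub-index p k<p = i , i<k , sym p≡
    where
    i : ℕ
    i = toℕ p ∸ suc k
    p≡ : suc (k + i) ≡ toℕ p
    p≡ = m+[n∸m]≡n k<p
    i<k : i < k
    i<k = +-cancelˡ-< k i k (s≤s⁻¹ (subst (_< n) (sym p≡) (toℕ<n p)))

  ∃-non-neighbour : ∀ p → k ≤ toℕ p → ∃ λ j → toℕ j < k × ¬ Adj j p
  ∃-non-neighbour p k≤p with m≤n⇒m<n∨m≡n k≤p
  ... | inj₂ k≡p = b₁ , b₁<k , λ b₁~p →
    <⇒≢ (inner-b-neighbour>k b₁~p (subst (0 <_) (sym toℕ-b₁) (s≤s z≤n)) b₁<k) k≡p
  ... | inj₁ k<p with hub-index p k<p
  ... | i , i<k , p≡ = j , subst (_< k) (sym toℕ-j) i<k , j≁p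
    where
    j : Fin n
    j = fromℕ< (<-trans i<k k<n)
    toℕ-j : toℕ j ≡ i
    toℕ-j = toℕ-fromℕ< (<-trans i<k k<n)
    j≁p : ¬ Adj j p
    j≁p j~p with b-neighbour-cases j~p (subst (_< k) (sym toℕ-j) i<k)
    ... | inj₁ (_ , p≡k)  = <⇒≢ k<p (sym p≡k)
    ... | inj₂ (_ , p≢)   = p≢ (trans p≡ (cong (λ t → suc (k + t)) (sym toℕ-j)))

  A B₀ : Subset n
  A  = initial (suc k)
  B₀ = initial k

  ∣A∣ : ∣ A ∣ ≡ suc k
  ∣A∣ = ∣initial∣ (suc k) k<n

  ∣B₀∣ : ∣ B₀ ∣ ≡ k
  ∣B₀∣ = ∣initial∣ k (<⇒≤ k<n)

  ∈A⇒≤k : ∀ {y} → y ∈ A → toℕ y ≤ k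
  ∈A⇒≤k y∈A = s≤s⁻¹ (∈-initial⁻ (suc k) y∈A)

  a∈A : a ∈ A
  a∈A = ∈-initial⁺ (suc k) (subst (_< suc k) (sym toℕ-a) (n<1+n k))

  B₀⊆A : B₀ ⊆ A
  B₀⊆A y∈B₀ = ∈-initial⁺ (suc k) (m<n⇒m<1+n (∈-initial⁻ k y∈B₀))

  hub-adjacent : ∀ {y} i (i<k : i < k) → toℕ y ≤ k → toℕ y ≢ i → Adj y (h i i<k)
  hub-adjacent {y} i i<k y≤k y≢i with m≤n⇒m<n∨m≡n y≤k
  ... | inj₂ y≡k = inj₁ (ah y≡k (k<h i i<k))
  ... | inj₁ y<k = inj₁ (bh y<k (k<h i i<k) λ h≡ →
    y≢i (sym (+-cancelˡ-≡ k i (toℕ y) (suc-injective (trans (sym (toℕ-h i i<k)) h≡)))))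

  module HubStar (L : Subset n) (i : ℕ) (i<k : i < k) (L⊆A : L ⊆ A)
                 (avoids-i : ∀ {y} → y ∈ L → toℕ y ≢ i) =
    Star G (h i i<k) L (λ y∈L → <-≤-trans (s≤s (∈A⇒≤k (L⊆A y∈L))) (k<h i i<k))
                       (λ y∈L → hub-adjacent i i<k (∈A⇒≤k (L⊆A y∈L)) (avoids-i y∈L))

  module Tree where
    b₀∉A-b₀ : b₀ ∉ A - b₀
    b₀∉A-b₀ b₀∈ = x∈p─q⇒x∉q A ⁅ b₀ ⁆ b₀∈ (x∈⁅x⁆ b₀)

    open HubStar (A - b₀) 0 0<k (p─q⊆p A ⁅ b₀ ⁆)
                 (λ y∈ y≡0 → b₀∉A-b₀ (subst (_∈ A - b₀) (toℕ-injective y≡0) y∈)) public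

    a∈A-b₀ : a ∈ A - b₀
    a∈A-b₀ = x∈p∧x≢y⇒x∈p-y a∈A (λ a≡b₀ → >⇒≢ 0<k (trans (sym toℕ-a) (cong toℕ a≡b₀)))

    b₀∉star : b₀ ∉ Subgraph.verts star
    b₀∉star b₀∈ with x∈p∪q⁻ (A - b₀) ⁅ h 0 0<k ⁆ b₀∈
    ... | inj₁ b₀∈A-b₀ = b₀∉A-b₀ b₀∈A-b₀
    ... | inj₂ b₀∈h₀ with cong toℕ (x∈⁅y⁆⇒x≡y _ b₀∈h₀)
    ...   | 0≡h₀ = 0≢1+n (trans 0≡h₀ (toℕ-h 0 0<k))

    open AddLeaf star star-connected b₀ a b₀∉star (L⊆star a∈A-b₀)
                 (inj₁ (b₀a refl toℕ-a)) (subst (0 <_) (sym toℕ-a) 0<k) public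

  T₀ : Subgraph G
  T₀ = Tree.grown

  a∈T₀ : a ∈ Subgraph.verts T₀
  a∈T₀ = p⊆p∪q ⁅ b₀ ⁆ (Tree.L⊆star Tree.a∈A-b₀)

  B₀⊆T₀ : B₀ ⊆ Subgraph.verts T₀
  B₀⊆T₀ {y} y∈B₀ with y ≟ b₀
  ... | yes refl = q⊆p∪q (Subgraph.verts Tree.star) ⁅ b₀ ⁆ (x∈⁅x⁆ b₀)
  ... | no  y≢b₀ = p⊆p∪q ⁅ b₀ ⁆ (Tree.L⊆star (x∈p∧x≢y⇒x∈p-y (B₀⊆A y∈B₀) y≢b₀))

  size-T₀ : size T₀ ≤ suc k
  size-T₀ = begin
    suc (size Tree.star) ≡⟨ cong suc Tree.size-star ⟩
    suc ∣ A - b₀ ∣       ≤⟨ x∈p⇒∣p-x∣<∣p∣ (B₀⊆A (∈-initial⁺ k 0<k)) ⟩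
    ∣ A ∣                ≡⟨ ∣A∣ ⟩
    suc k                ∎
    where open ≤-Reasoning

  connecting-B₀-needs-1+k-edges : ∀ (H : Subgraph G) → ConnContaining B₀ H → suc k ≤ size H
  connecting-B₀-needs-1+k-edges H (connected , B₀⊆H)
    with ∃-neighbour H connected (B₀⊆H (∈-initial⁺ k 0<k)) (B₀⊆H (∈-initial⁺ k b₁<k)) b₀≢b₁
  ... | p , b₀~p , p∈H with ∃-non-neighbour p (b-neighbour-≥k b₀~p 0<k)
  ... | j , j<k , j≁p = begin
    suc k              ≡⟨ cong suc (sym ∣B₀∣) ⟩
    suc ∣ B₀ ∣         ≤⟨ x∉p⇒∣p∣<∣p∪⁅x⁆∣ p∉B₀ ⟩
    ∣ B₀ ∪ ⁅ p ⁆ ∣     ≤⟨ isolated⇒∣S∣≤size H connected (p⊆q∧x∈q⇒p∪⁅x⁆⊆q B₀⊆H p∈H)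
                             (p⊆p∪q ⁅ p ⁆ (∈-initial⁺ k j<k)) 2≤∣S∣ j-isolated ⟩
    size H             ∎
    where
    open ≤-Reasoning
    p∉B₀ : p ∉ B₀
    p∉B₀ p∈B₀ = <⇒≱ (∈-initial⁻ k p∈B₀) (b-neighbour-≥k b₀~p 0<k)
    2≤∣S∣ : 2 ≤ ∣ B₀ ∪ ⁅ p ⁆ ∣
    2≤∣S∣ = ≤-trans 1<k (≤-trans (≤-reflexive (sym ∣B₀∣)) (<⇒≤ (x∉p⇒∣p∣<∣p∪⁅x⁆∣ p∉B₀)))
    j-isolated : IsolatedIn G j (B₀ ∪ ⁅ p ⁆)
    j-isolated j~v v∈ with x∈p∪q⁻ B₀ ⁅ p ⁆ v∈
    ... | inj₁ v∈B₀ = <⇒≱ (∈-initial⁻ k v∈B₀) (b-neighbour-≥k j~v j<k)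
    ... | inj₂ v∈p  = j≁p (subst (Adj j) (x∈⁅y⁆⇒x≡y p v∈p) j~v)

  T₀-Steiner : SteinerTree G B₀ T₀
  T₀-Steiner = (Tree.grown-connected , B₀⊆T₀) , λ H conn → ≤-trans size-T₀ (connecting-B₀-needs-1+k-edges H conn)

  A-not-k-GP : ¬ SteinerGP G k A
  A-not-k-GP gp = <-irrefl toℕ-a (∈-initial⁻ k a∈B₀)
    where
    a∈B₀ : a ∈ B₀
    a∈B₀ = subst (a ∈_) (gp B₀ B₀⊆A ∣B₀∣ T₀ T₀-Steiner)
                 (x∈p∩q⁺ (a∈T₀ , a∈A))

  connecting-A-subset-needs-∣C∣-edges : ∀ (H : Subgraph G) → Connected H → ∀ {C} → C ⊆ A → C ⊆ Subgraph.verts H →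
                  3 ≤ ∣ C ∣ → ∣ C ∣ ≤ size H
  connecting-A-subset-needs-∣C∣-edges H connected {C} C⊆A C⊆H 3≤∣C∣
    with ∣p∣<∣q∣⇒∃∈q∉p {p = ⁅ b₀ ⁆ ∪ ⁅ a ⁆} (<-≤-trans (s≤s ∣⁅b₀⁆∪⁅a⁆∣≤2) 3≤∣C∣)
    where
    ∣⁅b₀⁆∪⁅a⁆∣≤2 : ∣ ⁅ b₀ ⁆ ∪ ⁅ a ⁆ ∣ ≤ 2
    ∣⁅b₀⁆∪⁅a⁆∣≤2 = ≤-trans (∣p∪q∣≤∣p∣+∣q∣ ⁅ b₀ ⁆ ⁅ a ⁆)
                          (≤-reflexive (cong₂ _+_ (∣⁅x⁆∣≡1 b₀) (∣⁅x⁆∣≡1 a)))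
  ... | y , y∈C , y∉ = isolated⇒∣S∣≤size H connected C⊆H y∈C (≤-trans (n≤1+n 2) 3≤∣C∣) y-isolated
    where
    0<y : 0 < toℕ y
    0<y = n≢0⇒n>0 λ y≡0 →
      y∉ (p⊆p∪q ⁅ a ⁆ (subst (_∈ ⁅ b₀ ⁆) (sym (toℕ-injective y≡0)) (x∈⁅x⁆ b₀)))
    y<k : toℕ y < k
    y<k = ≤∧≢⇒< (∈A⇒≤k (C⊆A y∈C)) λ y≡k →
      y∉ (q⊆p∪q ⁅ b₀ ⁆ ⁅ a ⁆ (subst (_∈ ⁅ a ⁆) (sym (toℕ-injective (trans y≡k (sym toℕ-a)))) (x∈⁅x⁆ a)))
    y-isolated : IsolatedIn G y C
    y-isolated y~v v∈C = <⇒≱ (inner-b-neighbour>k y~v 0<y y<k) (∈A⇒≤k (C⊆A v∈C))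

  Steiner-size≤∣B∣ : ∀ {B T} → B ⊆ A → ∣ B ∣ < k → SteinerTree G B T → size T ≤ ∣ B ∣
  Steiner-size≤∣B∣ {B} B⊆A ∣B∣<k (_ , minimal)
    with ∣p∣<∣q∣⇒∃∈q∉p {p = B} {q = B₀} (subst (∣ B ∣ <_) (sym ∣B₀∣) ∣B∣<k)
  ... | x , x∈B₀ , x∉B = ≤-trans (minimal star (star-connected , L⊆star)) (≤-reflexive size-star)
    where
    open HubStar B (toℕ x) (∈-initial⁻ k x∈B₀) B⊆A
                 (λ y∈B y≡x → x∉B (subst (_∈ B) (toℕ-injective y≡x) y∈B))

  A-is-[k∸1]-GP : SteinerGP G (k ∸ 1) A
  A-is-[k∸1]-GP B B⊆A ∣B∣≡k∸1 T T-Steiner@((T-connected , B⊆T) , _) =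
    ⊆-antisym T∩A⊆B (λ y∈B → x∈p∩q⁺ (B⊆T y∈B , B⊆A y∈B))
    where
    k≡1+∣B∣ : k ≡ suc ∣ B ∣
    k≡1+∣B∣ = trans (sym (m+[n∸m]≡n 0<k)) (cong suc (sym ∣B∣≡k∸1))
    no-extra-vertex : ∀ {v} → v ∈ Subgraph.verts T → v ∈ A → ¬ v ∉ B
    no-extra-vertex {v} v∈T v∈A v∉B = <-irrefl refl (begin-strict
      ∣ B ∣           <⟨ x∉p⇒∣p∣<∣p∪⁅x⁆∣ v∉B ⟩
      ∣ B ∪ ⁅ v ⁆ ∣   ≤⟨ connecting-A-subset-needs-∣C∣-edges T T-connected (p⊆q∧x∈q⇒p∪⁅x⁆⊆q B⊆A v∈A)
                           (p⊆q∧x∈q⇒p∪⁅x⁆⊆q B⊆T v∈T) 3≤∣B∪v∣ ⟩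
      size T          ≤⟨ Steiner-size≤∣B∣ {T = T} B⊆A (≤-reflexive (sym k≡1+∣B∣)) T-Steiner ⟩
      ∣ B ∣           ∎)
      where
      open ≤-Reasoning
      3≤∣B∪v∣ : 3 ≤ ∣ B ∪ ⁅ v ⁆ ∣
      3≤∣B∪v∣ = ≤-trans 3≤k (≤-trans (≤-reflexive k≡1+∣B∣) (x∉p⇒∣p∣<∣p∪⁅x⁆∣ v∉B))
    T∩A⊆B : Subgraph.verts T ∩ A ⊆ B
    T∩A⊆B {v} v∈T∩A with x∈p∩q⁻ (Subgraph.verts T) A v∈T∩A
    ... | v∈T , v∈A = decidable-stable (v ∈? B) (no-extra-vertex v∈T v∈A)

proposition2p3 : ∀ (k : ℕ) → 3 ≤ k →
    Σ ℕ (λ n → Σ (Graph n) (λ G → Σ (Subset n) (λ A →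
      SteinerGP G (k ∸ 1) A × ¬ SteinerGP G k A)))
proposition2p3 k 3≤k = n , G , A , A-is-[k∸1]-GP , A-not-k-GP
  where open Construction k 3≤k
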